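{- Let $G_1$ and $G_2$ be finite simple graphs on disjoint vertex sets and $r$ a positive integer. Then $\Sigma_r(G_1 \sqcup G_2)$ is the simplicial complex whose set of facets is the union of the facets of $\Sigma_r(G_1) * \Delta_{V(G_2)}$ and the facets of $\Delta_{V(G_1)} * \Sigma_r(G_2)$.
   Context: For a graph $H$, $\Sigma_r(H)$ is the simplicial complex generated by $V(H)\setminus W$ over all $r$-subsets $W\subseteq V(H)$ with $H[W]$ connected. $G_1\sqcup G_2$ is the disjoint union of graphs. $\Delta_V$ is the simplex with vertex set $V$ (single facet $V$). The join $\Delta_1*\Delta_2$ of complexes on disjoint vertex sets has facets $F_1\sqcup F_2$ with $F_i$ a facet of $\Delta_i$. -}

module Defs where

open import Data.Nat using (ℕ; _+_)
open import Data.Fin using (Fin; splitAt)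
open import Data.Fin.Subset using (Subset; _∈_; _⊆_; ∁; ∣_∣)
open import Data.Vec using (_++_)
open import Data.Product using (Σ; ∃; ∃-syntax; _×_)
open import Data.Sum using (_⊎_; inj₁; inj₂)
open import Data.Unit using (⊤)
open import Data.Empty using (⊥)
open import Relation.Nullary using (¬_)
open import Relation.Binary.PropositionalEquality using (_≡_)

record Graph (n : ℕ) : Set₁ where
  field
    Adj   : Fin n → Fin n → Set
    sym   : ∀ {u v} → Adj u v → Adj v u
    irrefl : ∀ {u} → ¬ Adj u u
open Graph public

-- Disjoint union: G₁ on Fin n₁ and G₂ on Fin n₂ placed on Fin (n₁ + n₂)
-- (first n₁ vertices from G₁, the rest from G₂).
disjAdj : ∀ {n₁ n₂} → Graph n₁ → Graph n₂ → Fin (n₁ + n₂) → Fin (n₁ + n₂) → Set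
disjAdj {n₁} G₁ G₂ x y with splitAt n₁ x | splitAt n₁ y
... | inj₁ i | inj₁ j = Adj G₁ i j
... | inj₂ i | inj₂ j = Adj G₂ i j
... | inj₁ _ | inj₂ _ = ⊥
... | inj₂ _ | inj₁ _ = ⊥

disjSym : ∀ {n₁ n₂} (G₁ : Graph n₁) (G₂ : Graph n₂) {x y} → disjAdj G₁ G₂ x y → disjAdj G₁ G₂ y x
disjSym {n₁} G₁ G₂ {x} {y} a with splitAt n₁ x | splitAt n₁ y
... | inj₁ i | inj₁ j = sym G₁ a
... | inj₂ i | inj₂ j = sym G₂ a

disjIrrefl : ∀ {n₁ n₂} (G₁ : Graph n₁) (G₂ : Graph n₂) {x} → ¬ disjAdj G₁ G₂ x x
disjIrrefl {n₁} G₁ G₂ {x} a with splitAt n₁ x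
... | inj₁ i = irrefl G₁ a
... | inj₂ i = irrefl G₂ a

_⊔ᴳ_ : ∀ {n₁ n₂} → Graph n₁ → Graph n₂ → Graph (n₁ + n₂)
G₁ ⊔ᴳ G₂ = record { Adj = disjAdj G₁ G₂ ; sym = disjSym G₁ G₂ ; irrefl = disjIrrefl G₁ G₂ }

-- Walks inside a vertex subset W (i.e. walks in the induced subgraph H[W]).
data WalkIn {n : ℕ} (H : Graph n) (W : Subset n) : Fin n → Fin n → Set where
  here : ∀ {u} → u ∈ W → WalkIn H W u u
  step : ∀ {u v w} → u ∈ W → Adj H u v → WalkIn H W v w → WalkIn H W u w

InducedConnected : ∀ {n} → Graph n → Subset n → Set
InducedConnected H W = ∀ u v → u ∈ W → v ∈ W → WalkIn H W u v

Complex : ℕ → Set₁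
Complex n = Subset n → Set

Generated : ∀ {n} → (Subset n → Set) → Complex n
Generated Gen σ = ∃[ τ ] (Gen τ × σ ⊆ τ)

Facet : ∀ {n} → Complex n → Subset n → Set
Facet K σ = K σ × (∀ τ → K τ → σ ⊆ τ → τ ⊆ σ)

ΣGen : ∀ {n} → ℕ → Graph n → Subset n → Set
ΣGen r H τ = ∃[ W ] (∣ W ∣ ≡ r × InducedConnected H W × τ ≡ ∁ W)

Σᵣ : ∀ {n} → ℕ → Graph n → Complex n
Σᵣ r H = Generated (ΣGen r H)

Δ : (n : ℕ) → Complex n
Δ n σ = ⊤

Join : ∀ {n₁ n₂} → Complex n₁ → Complex n₂ → Complex (n₁ + n₂)
Join K₁ K₂ = Generated (λ τ → ∃[ F₁ ] ∃[ F₂ ] (Facet K₁ F₁ × Facet K₂ F₂ × τ ≡ F₁ ++ F₂))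

{-# OPTIONS --safe #-}
module Submission where

-- The generators V ∖ W of Σᵣ(H) all have |V| − r elements, so they form an antichain and
-- are exactly the facets; likewise the facets of a join are exactly the unions F₁ ⊔ F₂ of
-- facets, and the only facet of a simplex is its whole vertex set. So it suffices to compare
-- generators. An r-set W (r ≥ 1) inducing a connected subgraph of G₁ ⊔ G₂ is nonempty, and
-- walks never cross between the two sides, so W lies in V(G₁) or in V(G₂), where it is
-- connected; accordingly V ∖ W is (V(G₁) ∖ W) ⊔ V(G₂) or V(G₁) ⊔ (V(G₂) ∖ W).

open import Defs
open import Data.Nat using (ℕ; _≤_; _+_; _<_; suc)
open import Data.Fin.Subset using (Subset; ⊤; ⊥; ∁; ∣_∣; _∈_; _⊆_; _⊇_; Nonempty)
open import Data.Sum using (_⊎_; inj₁; inj₂)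
open import Function.Bundles using (_⇔_; mk⇔; Equivalence)
open import Data.Bool using (true; false; not)
open import Data.Empty using (⊥-elim)
open import Data.Fin using (Fin; splitAt; _↑ˡ_; _↑ʳ_)
open import Data.Fin.Properties
  using (splitAt-↑ˡ; splitAt-↑ʳ; splitAt⁻¹-↑ˡ; splitAt⁻¹-↑ʳ; ↑ˡ-injective; ↑ʳ-injective)
open import Data.Fin.Subset.Properties
  using (_∈?_; nonempty?; Empty-unique; ∣⊥∣≡0; ∈⊤; ∉⊥; ⊆-trans; ⊆-antisym;
         p⊂q⇒∣p∣<∣q∣; p⊆q⇒∁p⊇∁q; ∁p⊆∁q⇒p⊇q)
open import Data.Nat.Properties using (<-irrefl; +-identityʳ)
open import Data.Product using (∃-syntax; _×_; _,_; proj₂)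
open import Data.Sum.Function.Propositional using (_⊎-⇔_)
open import Data.Vec using ([]; _∷_; _++_)
import Data.Vec as Vec
open import Data.Vec.Properties
  using (lookup-++ˡ; lookup-++ʳ; []=⇒lookup; lookup⇒[]=; map-++; map-replicate)
import Function.Properties.Equivalence as ⇔
open import Function.Related.Propositional using (module EquationalReasoning)
open import Relation.Nullary using (¬_; yes; no)
open import Relation.Binary.PropositionalEquality as ≡ using (_≡_; _≢_; refl; cong; subst)

open Equivalence using (to; from)

private
  variable
    m n n₁ n₂ r : ℕ

p⊆q⇒∣p∣≡∣q∣⇒p⊇q : {p q : Subset n} → p ⊆ q → ∣ p ∣ ≡ ∣ q ∣ → p ⊇ q
p⊆q⇒∣p∣≡∣q∣⇒p⊇q {p = p} p⊆q ∣p∣≡∣q∣ {x} x∈q with x ∈? p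
... | yes x∈p = x∈p
... | no  x∉p = ⊥-elim (<-irrefl ∣p∣≡∣q∣ (p⊂q⇒∣p∣<∣q∣ (p⊆q , x , x∈q , x∉p)))

0<∣p∣⇒Nonempty : {p : Subset n} → 0 < ∣ p ∣ → Nonempty p
0<∣p∣⇒Nonempty {n} {p} 0<∣p∣ with nonempty? p
... | yes ne = ne
... | no ¬ne = ⊥-elim (<-irrefl (≡.sym (∣⊥∣≡0 n)) (subst (λ q → 0 < ∣ q ∣) (Empty-unique ¬ne) 0<∣p∣))

∣p++q∣≡∣p∣+∣q∣ : (p : Subset m) (q : Subset n) → ∣ p ++ q ∣ ≡ ∣ p ∣ + ∣ q ∣
∣p++q∣≡∣p∣+∣q∣ []          q = refl
∣p++q∣≡∣p∣+∣q∣ (true ∷ p)  q = cong suc (∣p++q∣≡∣p∣+∣q∣ p q)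
∣p++q∣≡∣p∣+∣q∣ (false ∷ p) q = ∣p++q∣≡∣p∣+∣q∣ p q

∣p++⊥∣≡∣p∣ : (p : Subset m) → ∣ p ++ ⊥ {n} ∣ ≡ ∣ p ∣
∣p++⊥∣≡∣p∣ {n = n} p =
  ≡.trans (∣p++q∣≡∣p∣+∣q∣ p ⊥) (≡.trans (cong (∣ p ∣ +_) (∣⊥∣≡0 n)) (+-identityʳ ∣ p ∣))

∣⊥++p∣≡∣p∣ : (p : Subset n) → ∣ ⊥ {m} ++ p ∣ ≡ ∣ p ∣
∣⊥++p∣≡∣p∣ {m = m} p = ≡.trans (∣p++q∣≡∣p∣+∣q∣ (⊥ {m}) p) (cong (_+ ∣ p ∣) (∣⊥∣≡0 m))

∁-++ : (p : Subset m) (q : Subset n) → ∁ (p ++ q) ≡ ∁ p ++ ∁ q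
∁-++ = map-++ not

∁⊥≡⊤ : ∁ (⊥ {n}) ≡ ⊤
∁⊥≡⊤ {n} = map-replicate not false n

∁[p++⊥]≡∁p++⊤ : (p : Subset m) → ∁ (p ++ ⊥ {n}) ≡ ∁ p ++ ⊤
∁[p++⊥]≡∁p++⊤ p = ≡.trans (∁-++ p ⊥) (cong (∁ p ++_) ∁⊥≡⊤)

∁[⊥++p]≡⊤++∁p : (p : Subset n) → ∁ (⊥ {m} ++ p) ≡ ⊤ ++ ∁ p
∁[⊥++p]≡⊤++∁p {m = m} p = ≡.trans (∁-++ (⊥ {m}) p) (cong (_++ ∁ p) ∁⊥≡⊤)

data Split (n₁ n₂ : ℕ) : Fin (n₁ + n₂) → Set where
  left  : (i : Fin n₁) → Split n₁ n₂ (i ↑ˡ n₂)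
  right : (j : Fin n₂) → Split n₁ n₂ (n₁ ↑ʳ j)

split : (x : Fin (n₁ + n₂)) → Split n₁ n₂ x
split {n₁} {n₂} x with splitAt n₁ x in eq
... | inj₁ i = subst (Split n₁ n₂) (splitAt⁻¹-↑ˡ eq) (left i)
... | inj₂ j = subst (Split n₁ n₂) (splitAt⁻¹-↑ʳ eq) (right j)

↑ˡ≢↑ʳ : {i : Fin n₁} {j : Fin n₂} → i ↑ˡ n₂ ≢ n₁ ↑ʳ j
↑ˡ≢↑ʳ {n₁} {n₂} {i} {j} eq
  with () ← ≡.trans (≡.sym (splitAt-↑ˡ n₁ i n₂)) (≡.trans (cong (splitAt n₁) eq) (splitAt-↑ʳ n₁ n₂ j))

∈-++ˡ : (p : Subset n₁) (q : Subset n₂) {i : Fin n₁} → i ↑ˡ n₂ ∈ p ++ q ⇔ i ∈ p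
∈-++ˡ p q {i} = mk⇔
  (λ i∈ → lookup⇒[]= i p (≡.trans (≡.sym (lookup-++ˡ p q i)) ([]=⇒lookup i∈)))
  (λ i∈ → lookup⇒[]= _ (p ++ q) (≡.trans (lookup-++ˡ p q i) ([]=⇒lookup i∈)))

∈-++ʳ : (p : Subset n₁) (q : Subset n₂) {j : Fin n₂} → n₁ ↑ʳ j ∈ p ++ q ⇔ j ∈ q
∈-++ʳ p q {j} = mk⇔
  (λ j∈ → lookup⇒[]= j q (≡.trans (≡.sym (lookup-++ʳ p q j)) ([]=⇒lookup j∈)))
  (λ j∈ → lookup⇒[]= _ (p ++ q) (≡.trans (lookup-++ʳ p q j) ([]=⇒lookup j∈)))

++-⊆ : {p p′ : Subset n₁} {q q′ : Subset n₂} → p ++ q ⊆ p′ ++ q′ ⇔ (p ⊆ p′ × q ⊆ q′)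
++-⊆ {n₁} {n₂} {p} {p′} {q} {q′} = mk⇔
  (λ s → (λ {i} i∈p → to (∈-++ˡ p′ q′) (s (from (∈-++ˡ p q) i∈p))) ,
         (λ {j} j∈q → to (∈-++ʳ p′ q′) (s (from (∈-++ʳ p q) j∈q))))
  (λ s {x} → go s (split x))
  where
  go : ∀ {x} → p ⊆ p′ × q ⊆ q′ → Split n₁ n₂ x → x ∈ p ++ q → x ∈ p′ ++ q′
  go (p⊆p′ , _) (left i)  x∈ = from (∈-++ˡ p′ q′) (p⊆p′ (to (∈-++ˡ p q) x∈))
  go (_ , q⊆q′) (right j) x∈ = from (∈-++ʳ p′ q′) (q⊆q′ (to (∈-++ʳ p q) x∈))

Antichain : (Subset n → Set) → Set
Antichain P = ∀ {τ τ′} → P τ → P τ′ → τ ⊆ τ′ → τ′ ⊆ τ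

facet-Generated : {Gen : Subset n → Set} → Antichain Gen → ∀ {σ} → Facet (Generated Gen) σ ⇔ Gen σ
facet-Generated {Gen = Gen} antichain {σ} = mk⇔ facet⇒Gen Gen⇒facet
  where
  facet⇒Gen : Facet (Generated Gen) σ → Gen σ
  facet⇒Gen ((τ , Gen-τ , σ⊆τ) , maximal) =
    subst Gen (⊆-antisym (maximal τ (τ , Gen-τ , λ x∈ → x∈) σ⊆τ) σ⊆τ) Gen-τ

  Gen⇒facet : Gen σ → Facet (Generated Gen) σ
  Gen⇒facet Gen-σ = (σ , Gen-σ , λ x∈ → x∈) , maximal
    where
    maximal : ∀ τ → Generated Gen τ → σ ⊆ τ → τ ⊆ σ
    maximal τ (τ′ , Gen-τ′ , τ⊆τ′) σ⊆τ = ⊆-trans τ⊆τ′ (antichain Gen-σ Gen-τ′ (⊆-trans σ⊆τ τ⊆τ′))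

Facet-antichain : (K : Complex n) → Antichain (Facet K)
Facet-antichain K (_ , maximal) (K-τ′ , _) = maximal _ K-τ′

-- Join K₁ K₂ is definitionally Generated (Facet K₁ ⊛ Facet K₂).
_⊛_ : (Subset n₁ → Set) → (Subset n₂ → Set) → Subset (n₁ + n₂) → Set
(P ⊛ Q) σ = ∃[ F₁ ] ∃[ F₂ ] (P F₁ × Q F₂ × σ ≡ F₁ ++ F₂)

⊛-antichain : {P : Subset n₁ → Set} {Q : Subset n₂ → Set} → Antichain P → Antichain Q → Antichain (P ⊛ Q)
⊛-antichain P-antichain Q-antichain (_ , _ , P-F₁ , Q-F₂ , refl) (_ , _ , P-F₁′ , Q-F₂′ , refl) F⊆F′ =
  let F₁⊆F₁′ , F₂⊆F₂′ = to ++-⊆ F⊆F′ in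
  from ++-⊆ (P-antichain P-F₁ P-F₁′ F₁⊆F₁′ , Q-antichain Q-F₂ Q-F₂′ F₂⊆F₂′)

⊛-cong : {P P′ : Subset n₁ → Set} {Q Q′ : Subset n₂ → Set} →
         (∀ {τ} → P τ ⇔ P′ τ) → (∀ {τ} → Q τ ⇔ Q′ τ) → ∀ {σ} → (P ⊛ Q) σ ⇔ (P′ ⊛ Q′) σ
⊛-cong P⇔P′ Q⇔Q′ = mk⇔
  (λ (F₁ , F₂ , P-F₁ , Q-F₂ , eq) → F₁ , F₂ , to P⇔P′ P-F₁ , to Q⇔Q′ Q-F₂ , eq)
  (λ (F₁ , F₂ , P-F₁ , Q-F₂ , eq) → F₁ , F₂ , from P⇔P′ P-F₁ , from Q⇔Q′ Q-F₂ , eq)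

facet-Join : (K₁ : Complex n₁) (K₂ : Complex n₂) → ∀ {σ} → Facet (Join K₁ K₂) σ ⇔ (Facet K₁ ⊛ Facet K₂) σ
facet-Join K₁ K₂ = facet-Generated (⊛-antichain (Facet-antichain K₁) (Facet-antichain K₂))

facet-Δ : ∀ {σ} → Facet (Δ n) σ ⇔ σ ≡ ⊤
facet-Δ = mk⇔
  (λ (_ , maximal) → ⊆-antisym (λ _ → ∈⊤) (maximal ⊤ _ (λ _ → ∈⊤)))
  (λ { refl → _ , λ _ _ _ _ → ∈⊤ })

ΣGen-antichain : (H : Graph n) → Antichain (ΣGen r H)
ΣGen-antichain H (W , ∣W∣≡r , _ , refl) (W′ , ∣W′∣≡r , _ , refl) ∁W⊆∁W′ =
  p⊆q⇒∁p⊇∁q (p⊆q⇒∣p∣≡∣q∣⇒p⊇q (∁p⊆∁q⇒p⊇q ∁W⊆∁W′) (≡.trans ∣W′∣≡r (≡.sym ∣W∣≡r)))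

facet-Σᵣ : (H : Graph n) → ∀ {σ} → Facet (Σᵣ r H) σ ⇔ ΣGen r H σ
facet-Σᵣ H = facet-Generated (ΣGen-antichain H)

record ComponentEmbedding (G : Graph m) (H : Graph n) : Set where
  field
    ι           : Fin m → Fin n
    ι-injective : ∀ {i k} → ι i ≡ ι k → i ≡ k
    adj⁺        : ∀ {i k} → Adj G i k → Adj H (ι i) (ι k)
    adj⁻        : ∀ {i v} → Adj H (ι i) v → ∃[ k ] (ι k ≡ v × Adj G i k)

module _ {G : Graph m} {H : Graph n} (E : ComponentEmbedding G H) where
  open ComponentEmbedding E

  walk-lift : ∀ {T S} → (∀ {j} → j ∈ T → ι j ∈ S) →
              ∀ {i k} → WalkIn G T i k → WalkIn H S (ι i) (ι k)
  walk-lift T⇒S (here i∈T)       = here (T⇒S i∈T)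
  walk-lift T⇒S (step i∈T adj w) = step (T⇒S i∈T) (adj⁺ adj) (walk-lift T⇒S w)

  walk-project : ∀ {T S} → (∀ {j} → ι j ∈ S → j ∈ T) →
                 ∀ {i v} → WalkIn H S (ι i) v → ∃[ k ] (ι k ≡ v × WalkIn G T i k)
  walk-project S⇒T (here ιi∈S) = _ , refl , here (S⇒T ιi∈S)
  walk-project S⇒T (step ιi∈S adj w) with adj⁻ adj
  ... | _ , refl , adjG with walk-project S⇒T w
  ...   | k , ιk≡v , wG = k , ιk≡v , step (S⇒T ιi∈S) adjG wG

  connected-⊆-image : ∀ {S i v} → InducedConnected H S → ι i ∈ S → v ∈ S → ∃[ k ] ι k ≡ v
  connected-⊆-image conn ιi∈S v∈S with walk-project {T = ⊤} (λ _ → ∈⊤) (conn _ _ ιi∈S v∈S)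
  ... | k , ιk≡v , _ = k , ιk≡v

  connected-restrict : ∀ {T S} → (∀ {j} → ι j ∈ S ⇔ j ∈ T) → InducedConnected H S → InducedConnected G T
  connected-restrict S⇔T conn a b a∈T b∈T
    with walk-project (to S⇔T) (conn (ι a) (ι b) (from S⇔T a∈T) (from S⇔T b∈T))
  ... | _ , ιk≡ιb , w = subst (WalkIn G _ a) (ι-injective ιk≡ιb) w

  connected-extend : ∀ {T S} → (∀ {j} → ι j ∈ S ⇔ j ∈ T) → (∀ {v} → v ∈ S → ∃[ j ] ι j ≡ v) →
                     InducedConnected G T → InducedConnected H S
  connected-extend S⇔T S⊆image conn u v u∈S v∈S with S⊆image u∈S | S⊆image v∈S
  ... | i , refl | k , refl = walk-lift (from S⇔T) (conn i k (to S⇔T u∈S) (to S⇔T v∈S))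

module _ (G₁ : Graph n₁) (G₂ : Graph n₂) where

  ⊔-adj-↑ˡ : ∀ {i k} → Adj (G₁ ⊔ᴳ G₂) (i ↑ˡ n₂) (k ↑ˡ n₂) ⇔ Adj G₁ i k
  ⊔-adj-↑ˡ {i} {k} rewrite splitAt-↑ˡ n₁ i n₂ | splitAt-↑ˡ n₁ k n₂ = ⇔.refl

  ⊔-adj-↑ʳ : ∀ {j l} → Adj (G₁ ⊔ᴳ G₂) (n₁ ↑ʳ j) (n₁ ↑ʳ l) ⇔ Adj G₂ j l
  ⊔-adj-↑ʳ {j} {l} rewrite splitAt-↑ʳ n₁ n₂ j | splitAt-↑ʳ n₁ n₂ l = ⇔.refl

  ⊔-¬adj-↑ˡ-↑ʳ : ∀ {i j} → ¬ Adj (G₁ ⊔ᴳ G₂) (i ↑ˡ n₂) (n₁ ↑ʳ j)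
  ⊔-¬adj-↑ˡ-↑ʳ {i} {j} rewrite splitAt-↑ˡ n₁ i n₂ | splitAt-↑ʳ n₁ n₂ j = λ ()

  ⊔-¬adj-↑ʳ-↑ˡ : ∀ {j i} → ¬ Adj (G₁ ⊔ᴳ G₂) (n₁ ↑ʳ j) (i ↑ˡ n₂)
  ⊔-¬adj-↑ʳ-↑ˡ {j} {i} rewrite splitAt-↑ʳ n₁ n₂ j | splitAt-↑ˡ n₁ i n₂ = λ ()

  ↑ˡ-embedding : ComponentEmbedding G₁ (G₁ ⊔ᴳ G₂)
  ↑ˡ-embedding = record
    { ι           = _↑ˡ n₂
    ; ι-injective = ↑ˡ-injective n₂ _ _
    ; adj⁺        = from ⊔-adj-↑ˡ
    ; adj⁻        = λ adj → adj⁻ adj (split _)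
    }
    where
    adj⁻ : ∀ {i v} → Adj (G₁ ⊔ᴳ G₂) (i ↑ˡ n₂) v → Split n₁ n₂ v → ∃[ k ] (k ↑ˡ n₂ ≡ v × Adj G₁ i k)
    adj⁻ adj (left k)  = k , refl , to ⊔-adj-↑ˡ adj
    adj⁻ adj (right _) = ⊥-elim (⊔-¬adj-↑ˡ-↑ʳ adj)

  ↑ʳ-embedding : ComponentEmbedding G₂ (G₁ ⊔ᴳ G₂)
  ↑ʳ-embedding = record
    { ι           = n₁ ↑ʳ_
    ; ι-injective = ↑ʳ-injective n₁ _ _
    ; adj⁺        = from ⊔-adj-↑ʳ
    ; adj⁻        = λ adj → adj⁻ adj (split _)
    }
    where
    adj⁻ : ∀ {j v} → Adj (G₁ ⊔ᴳ G₂) (n₁ ↑ʳ j) v → Split n₁ n₂ v → ∃[ l ] (n₁ ↑ʳ l ≡ v × Adj G₂ j l)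
    adj⁻ adj (left _)  = ⊥-elim (⊔-¬adj-↑ʳ-↑ˡ adj)
    adj⁻ adj (right l) = l , refl , to ⊔-adj-↑ʳ adj

  ⊔-connected⇒one-sided : {W₁ : Subset n₁} {W₂ : Subset n₂} →
                          Nonempty (W₁ ++ W₂) → InducedConnected (G₁ ⊔ᴳ G₂) (W₁ ++ W₂) →
                          (InducedConnected G₁ W₁ × W₂ ≡ ⊥) ⊎ (InducedConnected G₂ W₂ × W₁ ≡ ⊥)
  ⊔-connected⇒one-sided {W₁} {W₂} (x , x∈W) conn with split {n₁} {n₂} x
  ... | left _ = inj₁ (connected-restrict ↑ˡ-embedding (∈-++ˡ W₁ W₂) conn , Empty-unique λ (j , j∈W₂) →
    ↑ˡ≢↑ʳ (proj₂ (connected-⊆-image ↑ˡ-embedding conn x∈W (from (∈-++ʳ W₁ W₂) j∈W₂))))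
  ... | right _ = inj₂ (connected-restrict ↑ʳ-embedding (∈-++ʳ W₁ W₂) conn , Empty-unique λ (i , i∈W₁) →
    ↑ˡ≢↑ʳ (≡.sym (proj₂ (connected-⊆-image ↑ʳ-embedding conn x∈W (from (∈-++ˡ W₁ W₂) i∈W₁)))))

  ⊔-connected-++⊥ : {W₁ : Subset n₁} → InducedConnected G₁ W₁ → InducedConnected (G₁ ⊔ᴳ G₂) (W₁ ++ ⊥)
  ⊔-connected-++⊥ {W₁} = connected-extend ↑ˡ-embedding (∈-++ˡ W₁ ⊥) (λ {v} → ⊆-image (split v))
    where
    ⊆-image : ∀ {v} → Split n₁ n₂ v → v ∈ W₁ ++ ⊥ → ∃[ i ] i ↑ˡ n₂ ≡ v
    ⊆-image (left i)  _   = i , refl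
    ⊆-image (right _) v∈W = ⊥-elim (∉⊥ (to (∈-++ʳ W₁ ⊥) v∈W))

  ⊔-connected-⊥++ : {W₂ : Subset n₂} → InducedConnected G₂ W₂ → InducedConnected (G₁ ⊔ᴳ G₂) (⊥ ++ W₂)
  ⊔-connected-⊥++ {W₂} = connected-extend ↑ʳ-embedding (∈-++ʳ ⊥ W₂) (λ {v} → ⊆-image (split v))
    where
    ⊆-image : ∀ {v} → Split n₁ n₂ v → v ∈ ⊥ ++ W₂ → ∃[ j ] n₁ ↑ʳ j ≡ v
    ⊆-image (left _)  v∈W = ⊥-elim (∉⊥ (to (∈-++ˡ ⊥ W₂) v∈W))
    ⊆-image (right j) _   = j , refl

  ΣGen-⊔ : 1 ≤ r → ∀ {σ} →
           ΣGen r (G₁ ⊔ᴳ G₂) σ ⇔ ((ΣGen r G₁ ⊛ (_≡ ⊤)) σ ⊎ ((_≡ ⊤) ⊛ ΣGen r G₂) σ)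
  ΣGen-⊔ {r} 1≤r = mk⇔ to-sides from-sides
    where
    to-sides : ∀ {σ} → ΣGen r (G₁ ⊔ᴳ G₂) σ → (ΣGen r G₁ ⊛ (_≡ ⊤)) σ ⊎ ((_≡ ⊤) ⊛ ΣGen r G₂) σ
    to-sides (W , ∣W∣≡r , conn , refl) with Vec.splitAt n₁ W
    ... | W₁ , W₂ , refl with ⊔-connected⇒one-sided {W₁} {W₂}
                 (0<∣p∣⇒Nonempty (subst (0 <_) (≡.sym ∣W∣≡r) 1≤r)) conn
    ...   | inj₁ (conn₁ , refl) =
      inj₁ (∁ W₁ , ⊤ , (W₁ , ≡.trans (≡.sym (∣p++⊥∣≡∣p∣ W₁)) ∣W∣≡r , conn₁ , refl) , refl , ∁[p++⊥]≡∁p++⊤ W₁)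
    ...   | inj₂ (conn₂ , refl) =
      inj₂ (⊤ , ∁ W₂ , refl , (W₂ , ≡.trans (≡.sym (∣⊥++p∣≡∣p∣ {m = n₁} W₂)) ∣W∣≡r , conn₂ , refl) ,
            ∁[⊥++p]≡⊤++∁p W₂)

    from-sides : ∀ {σ} → (ΣGen r G₁ ⊛ (_≡ ⊤)) σ ⊎ ((_≡ ⊤) ⊛ ΣGen r G₂) σ → ΣGen r (G₁ ⊔ᴳ G₂) σ
    from-sides (inj₁ (_ , _ , (W₁ , ∣W₁∣≡r , conn₁ , refl) , refl , refl)) =
      W₁ ++ ⊥ , ≡.trans (∣p++⊥∣≡∣p∣ W₁) ∣W₁∣≡r , ⊔-connected-++⊥ conn₁ ,
      ≡.sym (∁[p++⊥]≡∁p++⊤ W₁)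
    from-sides (inj₂ (_ , _ , refl , (W₂ , ∣W₂∣≡r , conn₂ , refl) , refl)) =
      ⊥ ++ W₂ , ≡.trans (∣⊥++p∣≡∣p∣ {m = n₁} W₂) ∣W₂∣≡r , ⊔-connected-⊥++ conn₂ ,
      ≡.sym (∁[⊥++p]≡⊤++∁p W₂)

lemma3p11 : ∀ {n₁ n₂} (G₁ : Graph n₁) (G₂ : Graph n₂) (r : ℕ) → 1 ≤ r →
    ∀ (σ : Subset (n₁ + n₂)) →
      Facet (Σᵣ r (G₁ ⊔ᴳ G₂)) σ
        ⇔ (Facet (Join (Σᵣ r G₁) (Δ n₂)) σ ⊎ Facet (Join (Δ n₁) (Σᵣ r G₂)) σ)
lemma3p11 {n₁} {n₂} G₁ G₂ r 1≤r σ = begin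
  Facet (Σᵣ r (G₁ ⊔ᴳ G₂)) σ
    ∼⟨ facet-Σᵣ (G₁ ⊔ᴳ G₂) ⟩
  ΣGen r (G₁ ⊔ᴳ G₂) σ
    ∼⟨ ΣGen-⊔ G₁ G₂ 1≤r ⟩
  ((ΣGen r G₁ ⊛ (_≡ ⊤)) σ ⊎ ((_≡ ⊤) ⊛ ΣGen r G₂) σ)
    ∼⟨ ⇔.sym (⊛-cong (facet-Σᵣ G₁) facet-Δ ⊎-⇔ ⊛-cong facet-Δ (facet-Σᵣ G₂)) ⟩
  ((Facet (Σᵣ r G₁) ⊛ Facet (Δ n₂)) σ ⊎ (Facet (Δ n₁) ⊛ Facet (Σᵣ r G₂)) σ)
    ∼⟨ ⇔.sym (facet-Join (Σᵣ r G₁) (Δ n₂) ⊎-⇔ facet-Join (Δ n₁) (Σᵣ r G₂)) ⟩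
  (Facet (Join (Σᵣ r G₁) (Δ n₂)) σ ⊎ Facet (Join (Δ n₁) (Σᵣ r G₂)) σ) ∎
  where open EquationalReasoning
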